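{- The theory $\mathsf{PA}^-_{\mathsf{jer}}$ plus the Primality Principle $x\mid y\cdot z\to\exists u\,\exists v\,(x=u\cdot v\wedge u\mid y\wedge v\mid z)$ proves: if $\mathsf{pow}_2(x)$ and $\mathsf{pow}_2(y)$, then $\mathsf{pow}_2(x\cdot y)$.
   Context: $\mathsf{PA}^-_{\mathsf{jer}}$ is the theory in the language $0,1,+,\times,\leq$ with axioms: $x+0=x$; $x+y=y+x$; $(x+y)+z=x+(y+z)$; $x\cdot1=x$; $x\cdot y=y\cdot x$; $(x\cdot y)\cdot z=x\cdot(y\cdot z)$; $x\cdot(y+z)=x\cdot y+x\cdot z$; $x\leq y\vee y\leq x$; $(x\leq y\wedge y\leq z)\to x\leq z$; $x+1\not\leq x$; $y\leq x\to(y=x\vee y+1\leq x)$; $y\leq x\to y+z\leq x+z$; $y\leq x\to y\cdot z\leq x\cdot z$. $x\mid y$ means $\exists z\,z\cdot x=y$; $2:=1+1$; $\mathsf{pow}_2(x)$ means $\forall y\,(y\mid x\to(y=1\vee 2\mid y))$. -}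

module Defs where

open import Level using (Level; suc)
open import Data.Product using (Σ; _×_; _,_)
open import Data.Sum using (_⊎_)
open import Relation.Nullary using (¬_)
open import Relation.Binary.PropositionalEquality using (_≡_)

record PAjerModel (ℓ : Level) : Set (suc ℓ) where
  infixl 6 _+_
  infixl 7 _·_
  infix 4 _≤_
  field
    M   : Set ℓ
    𝟎 𝟏 : M
    _+_ _·_ : M → M → M
    _≤_ : M → M → Set ℓ
    +-zero  : ∀ x → x + 𝟎 ≡ x
    +-comm  : ∀ x y → x + y ≡ y + x
    +-assoc : ∀ x y z → (x + y) + z ≡ x + (y + z)
    ·-one   : ∀ x → x · 𝟏 ≡ x
    ·-comm  : ∀ x y → x · y ≡ y · x
    ·-assoc : ∀ x y z → (x · y) · z ≡ x · (y · z)
    distrib : ∀ x y z → x · (y + z) ≡ x · y + x · z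
    ≤-total : ∀ x y → x ≤ y ⊎ y ≤ x
    ≤-trans : ∀ x y z → x ≤ y → y ≤ z → x ≤ z
    succ-not-≤ : ∀ x → ¬ (x + 𝟏 ≤ x)
    ≤-discrete : ∀ x y → y ≤ x → (y ≡ x ⊎ y + 𝟏 ≤ x)
    ≤-+ : ∀ x y z → y ≤ x → y + z ≤ x + z
    ≤-· : ∀ x y z → y ≤ x → y · z ≤ x · z

  _∣_ : M → M → Set ℓ
  x ∣ y = Σ M (λ z → z · x ≡ y)

  𝟐 : M
  𝟐 = 𝟏 + 𝟏

  pow₂ : M → Set ℓ
  pow₂ x = ∀ y → y ∣ x → (y ≡ 𝟏 ⊎ 𝟐 ∣ y)

  PrimalityPrinciple : Set ℓ
  PrimalityPrinciple =
    ∀ x y z → x ∣ (y · z) → Σ M (λ u → Σ M (λ v → (x ≡ u · v) × (u ∣ y) × (v ∣ z)))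

{-# OPTIONS --safe #-}
module Submission where

open import Defs
open import Level using (Level)
open import Data.Product using (_,_)
open import Data.Sum using (inj₁; inj₂)
open import Relation.Binary.PropositionalEquality
  using (refl; sym; trans; cong; subst; module ≡-Reasoning)

module Pow₂ {ℓ : Level} (𝓜 : PAjerModel ℓ) where
  open PAjerModel 𝓜

  ∣m⇒∣m·n : ∀ {d m} n → d ∣ m → d ∣ (m · n)
  ∣m⇒∣m·n {d} {m} n (c , c·d≡m) = c · n , (begin
    (c · n) · d  ≡⟨ ·-assoc c n d ⟩
    c · (n · d)  ≡⟨ cong (c ·_) (·-comm n d) ⟩
    c · (d · n)  ≡⟨ sym (·-assoc c d n) ⟩
    (c · d) · n  ≡⟨ cong (_· n) c·d≡m ⟩
    m · n        ∎)
    where open ≡-Reasoning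

  ∣n⇒∣m·n : ∀ {d n} m → d ∣ n → d ∣ (m · n)
  ∣n⇒∣m·n {d} {n} m d∣n = subst (d ∣_) (·-comm n m) (∣m⇒∣m·n m d∣n)

  pow₂-· : PrimalityPrinciple → ∀ x y → pow₂ x → pow₂ y → pow₂ (x · y)
  pow₂-· primality x y pow₂x pow₂y w w∣xy
    with primality w x y w∣xy
  ... | u , v , w≡uv , u∣x , v∣y
    with pow₂x u u∣x | pow₂y v v∣y
  ... | inj₁ refl | inj₁ refl = inj₁ (trans w≡uv (·-one 𝟏))
  ... | inj₂ 2∣u  | _         = inj₂ (subst (𝟐 ∣_) (sym w≡uv) (∣m⇒∣m·n v 2∣u))
  ... | inj₁ _    | inj₂ 2∣v  = inj₂ (subst (𝟐 ∣_) (sym w≡uv) (∣n⇒∣m·n u 2∣v))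

mainTheorem12 : ∀ {ℓ : Level} (𝓜 : PAjerModel ℓ) → PAjerModel.PrimalityPrinciple 𝓜 →
    ∀ x y → PAjerModel.pow₂ 𝓜 x → PAjerModel.pow₂ 𝓜 y →
    PAjerModel.pow₂ 𝓜 (PAjerModel._·_ 𝓜 x y)
mainTheorem12 𝓜 = Pow₂.pow₂-· 𝓜
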